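{- Let $P$ and $Q$ be Laurent polynomials in $x_1,\ldots,x_r$ with coefficients in $\mathbb{Z}/p^a\mathbb{Z}$ ($p$ prime, $a\geq1$), and let $\tilde P$ and $\ell$ be as in the context. Then for all $n\in\mathbb{N}$ and all $k\in\{0,1,\ldots,p^{a-1}-1\}$, $$\mathrm{ct}\left(P^{p^{a-1}n+k}Q\right)\equiv\mathrm{ct}\left(\tilde P^n\cdot\Lambda_{p^\ell}(P^kQ)\right)\pmod{p^a}.$$
   Context: $\mathrm{ct}(Q)$ denotes the constant term of a Laurent polynomial $Q$. $\tilde P$ is the Laurent polynomial with coefficients in $\mathbb{Z}/p^a\mathbb{Z}$ such that $P(x_1,\ldots,x_r)^{p^{a-1}}\equiv\tilde P(x_1^{p^\ell},\ldots,x_r^{p^\ell})\pmod{p^a}$, where $\ell$ is taken as large as possible. For a positive integer $N$, $\Lambda_N$ is the map on Laurent polynomials defined by $\Lambda_N\left(\sum_i q_i\mathbf{x}^i\right)=\sum_{i:\,N\mid i}q_i\mathbf{x}^{i/N}$, where $i\in\mathbb{Z}^r$, $\mathbf{x}^i=x_1^{i_1}\cdots x_r^{i_r}$, and $N\mid i$ means $N$ divides every coordinate of $i$ (i.e. it deletes terms whose exponents are not all multiples of $N$ and substitutes $x_j^N\mapsto x_j$). -}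

module Defs where

open import Data.Nat as ℕ using (ℕ; zero; suc)
open import Data.Nat.Divisibility as ℕD using (_∣?_)
open import Data.Integer as ℤ using (ℤ; +_; ∣_∣; _/ℕ_)
open import Data.Integer.Divisibility as ℤD using ()
open import Data.Vec as Vec using (Vec; zipWith; replicate)
open import Data.Vec.Properties using (≡-dec)
open import Data.Vec.Relation.Unary.All as All using (all?)
open import Data.List as List using (List; []; _∷_; _++_; concatMap; map; foldr)
open import Data.Product using (_×_; _,_)
open import Relation.Nullary using (yes; no)
open import Data.Empty using (⊥)
open import Relation.Binary.PropositionalEquality using (_≡_)

-- A Laurent polynomial in r variables x₁,…,x_r, given as a finite list of
-- terms (exponent vector i ∈ ℤ^r, coefficient c), meaning Σ c·x^i.
-- Coefficients are integers; everything is considered modulo p^a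
-- (coefficientwise congruence), i.e. integer lifts of Z/p^aZ-coefficients.
LPoly : ℕ → Set
LPoly r = List (Vec ℤ r × ℤ)

coeff : ∀ {r} → LPoly r → Vec ℤ r → ℤ
coeff [] e = + 0
coeff ((i , c) ∷ P) e with ≡-dec ℤ._≟_ i e
... | yes _ = c ℤ.+ coeff P e
... | no  _ = coeff P e

ct : ∀ {r} → LPoly r → ℤ
ct {r} P = coeff P (replicate r (+ 0))

one : ∀ {r} → LPoly r
one {r} = (replicate r (+ 0) , + 1) ∷ []

_·_ : ∀ {r} → LPoly r → LPoly r → LPoly r
P · Q = concatMap (λ { (i , c) → map (λ { (j , d) → (zipWith ℤ._+_ i j , c ℤ.* d) }) Q }) P

infixl 7 _·_
infixr 8 _^_

_^_ : ∀ {r} → LPoly r → ℕ → LPoly r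
P ^ zero = one
P ^ suc n = P · (P ^ n)

substPow : ∀ {r} → ℕ → LPoly r → LPoly r
substPow N P = map (λ { (i , c) → (Vec.map (λ z → + N ℤ.* z) i , c) }) P

-- Λ_N : keep the terms whose exponents are all divisible by N and
-- substitute x_j^N ↦ x_j.  (Only meaningful for N ≥ 1; for N = 0 we
-- return the zero polynomial, a case never used below since N = p^ℓ.)
Λ : ∀ {r} → ℕ → LPoly r → LPoly r
Λ zero P = []
Λ (suc m) [] = []
Λ (suc m) ((i , c) ∷ P) with all? (λ z → suc m ∣? ∣ z ∣) i
... | yes _ = (Vec.map (λ z → z /ℕ suc m) i , c) ∷ Λ (suc m) P
... | no  _ = Λ (suc m) P

_≡[mod_]_ : ℤ → ℕ → ℤ → Set
x ≡[mod m ] y = (+ m) ℤD.∣ (x ℤ.- y)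

_≅[mod_]_ : ∀ {r} → LPoly r → ℕ → LPoly r → Set
_≅[mod_]_ {r} P m Q = (e : Vec ℤ r) → coeff P e ≡[mod m ] coeff Q e

IsTilde : ∀ {r} → (p a : ℕ) → LPoly r → LPoly r → ℕ → Set
IsTilde {r} p a P Pt ℓ =
  ((P ^ (p ℕ.^ (a ℕ.∸ 1))) ≅[mod p ℕ.^ a ] substPow (p ℕ.^ ℓ) Pt)
  × ((ℓ' : ℕ) → ℓ ℕ.< ℓ' → (Pt' : LPoly r) →
       ((P ^ (p ℕ.^ (a ℕ.∸ 1))) ≅[mod p ℕ.^ a ] substPow (p ℕ.^ ℓ') Pt') → ⊥)

-- Put M = p^(a-1) and N = p^ℓ. Then P^(Mn+k)·Q = (P^M)^n · P^k·Q ≡ P̃(x^N)^n · P^k·Q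
-- mod p^a, and ct(S(x^N)·R) = ct(S·Λ_N R) because x^(Ni)·x^j is constant exactly when
-- N divides j and i + j/N = 0.  Since a polynomial given as a list of terms may repeat
-- exponents, congruences are handled through the pairings Σ c·w(i) of P = Σ c·x^i with
-- arbitrary integer weights w on exponents: they are additive, turn products into
-- iterated pairings, and recover the coefficients from indicator weights.

module Submission where

open import Defs
open import Data.Nat as ℕ using (ℕ; zero; suc; NonZero; z≤n; s≤s)
import Data.Nat.Properties as ℕ
import Data.Nat.Divisibility as ℕ
open import Data.Nat.Primality using (Prime; prime⇒nonZero)
open import Data.Integer
  using (ℤ; +_; -[1+_]; 0ℤ; 1ℤ; _+_; _*_; -_; _-_; ∣_∣; _/ℕ_; _%ℕ_; _≟_)
open import Data.Integer.Properties
open import Data.Integer.DivMod using (a≡a%ℕn+[a/ℕn]*n)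
import Data.Integer.Divisibility.Signed as Signed
open import Data.Integer.Tactic.RingSolver using (solve-∀)
open import Data.Vec as Vec using (Vec; []; _∷_; zipWith; replicate)
open import Data.Vec.Properties using (≡-dec; ∷-injective; map-replicate)
open import Data.Vec.Relation.Unary.All using (All; []; _∷_; all?)
open import Data.Vec.Relation.Binary.Pointwise.Inductive
  using (Pointwise-≡⇒≡; zipWith-assoc; zipWith-identityˡ)
open import Data.List using ([]; _∷_; _++_; concatMap; map; length)
open import Data.Product using (_×_; _,_; proj₁; proj₂; map₂)
open import Data.Empty using (⊥-elim)
open import Function using (_∘_)
open import Relation.Nullary using (¬_; yes; no)
open import Relation.Binary using (Setoid)
open import Relation.Binary.PropositionalEquality
import Relation.Binary.Reasoning.Setoid as SetoidReasoning

infix 4 _≋_[mod_]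

-- A record wrapper around _≡[mod_]_, so that x and y can be inferred from a proof.
record _≋_[mod_] (x y : ℤ) (m : ℕ) : Set where
  constructor mod-divides
  field divides-difference : + m Signed.∣ x - y

module _ {m : ℕ} where

  private
    via : ∀ {a x y} → a ≡ x - y → + m Signed.∣ a → x ≋ y [mod m ]
    via eq d = mod-divides (subst (+ m Signed.∣_) eq d)

  ≋⇒≡[mod] : ∀ {x y} → x ≋ y [mod m ] → x ≡[mod m ] y
  ≋⇒≡[mod] (mod-divides d) = Signed.∣⇒∣ᵤ d

  ≡[mod]⇒≋ : ∀ {x y} → x ≡[mod m ] y → x ≋ y [mod m ]
  ≡[mod]⇒≋ d = mod-divides (Signed.∣ᵤ⇒∣ d)

  ≡⇒≋ : ∀ {x y} → x ≡ y → x ≋ y [mod m ]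
  ≡⇒≋ {x} refl = mod-divides (Signed.divides 0ℤ (+-inverseʳ x))

  ≋-sym : ∀ {x y} → x ≋ y [mod m ] → y ≋ x [mod m ]
  ≋-sym {x} {y} (mod-divides d) = via (lemma x y) (Signed.∣m⇒∣-m d)
    where lemma : ∀ a b → - (a - b) ≡ b - a
          lemma = solve-∀

  ≋-trans : ∀ {x y z} → x ≋ y [mod m ] → y ≋ z [mod m ] → x ≋ z [mod m ]
  ≋-trans {x} {y} {z} (mod-divides d) (mod-divides e) = via (lemma x y z) (Signed.∣m∣n⇒∣m+n d e)
    where lemma : ∀ a b c → (a - b) + (b - c) ≡ a - c
          lemma = solve-∀

  +-cong-≋ : ∀ {x y u v} → x ≋ y [mod m ] → u ≋ v [mod m ] → x + u ≋ y + v [mod m ]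
  +-cong-≋ {x} {y} {u} {v} (mod-divides d) (mod-divides e) = via (lemma x y u v) (Signed.∣m∣n⇒∣m+n d e)
    where lemma : ∀ a b c d → (a - b) + (c - d) ≡ (a + c) - (b + d)
          lemma = solve-∀

  *-congʳ-≋ : ∀ {x y} c → x ≋ y [mod m ] → x * c ≋ y * c [mod m ]
  *-congʳ-≋ {x} {y} c (mod-divides d) = via (lemma x y c) (Signed.∣m⇒∣m*n c d)
    where lemma : ∀ a b c → (a - b) * c ≡ a * c - b * c
          lemma = solve-∀

  *-congˡ-≋ : ∀ {x y} c → x ≋ y [mod m ] → c * x ≋ c * y [mod m ]
  *-congˡ-≋ {x} {y} c (mod-divides d) = via (lemma x y c) (Signed.∣n⇒∣m*n c d)
    where lemma : ∀ a b c → c * (a - b) ≡ c * a - c * b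
          lemma = solve-∀

  ≋⇒-≋0 : ∀ {x y} → x ≋ y [mod m ] → x - y ≋ 0ℤ [mod m ]
  ≋⇒-≋0 {x} {y} (mod-divides d) = via (lemma x y) d
    where lemma : ∀ a b → a - b ≡ (a - b) - 0ℤ
          lemma = solve-∀

  -≋0⇒≋ : ∀ {x y} → x - y ≋ 0ℤ [mod m ] → x ≋ y [mod m ]
  -≋0⇒≋ {x} {y} (mod-divides d) = via (lemma x y) d
    where lemma : ∀ a b → (a - b) - 0ℤ ≡ a - b
          lemma = solve-∀

  ≋-setoid : Setoid _ _
  ≋-setoid = record
    { Carrier = ℤ
    ; _≈_ = _≋_[mod m ]
    ; isEquivalence = record { refl = ≡⇒≋ refl ; sym = ≋-sym ; trans = ≋-trans }
    }

-- Pairing a Laurent polynomial with a weight on exponents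

Weight : ℕ → Set
Weight r = Vec ℤ r → ℤ

infixl 6 _⊕_

_⊕_ : ∀ {r} → Vec ℤ r → Vec ℤ r → Vec ℤ r
_⊕_ = zipWith _+_

pair : ∀ {r} → Weight r → LPoly r → ℤ
pair w [] = 0ℤ
pair w ((i , c) ∷ P) = w i * c + pair w P

module _ {r : ℕ} where

  pair-++ : ∀ w (A B : LPoly r) → pair w (A ++ B) ≡ pair w A + pair w B
  pair-++ w [] B = sym (+-identityˡ _)
  pair-++ w ((i , c) ∷ A) B =
    trans (cong (λ t → w i * c + t) (pair-++ w A B)) (sym (+-assoc (w i * c) _ _))

  pair-cong : ∀ {u v : Weight r} → (∀ i → u i ≡ v i) → ∀ P → pair u P ≡ pair v P
  pair-cong u≗v [] = refl
  pair-cong u≗v ((i , c) ∷ P) = cong₂ (λ a t → a * c + t) (u≗v i) (pair-cong u≗v P)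

  pair-0 : ∀ P → pair {r} (λ _ → 0ℤ) P ≡ 0ℤ
  pair-0 [] = refl
  pair-0 ((i , c) ∷ P) = trans (+-identityˡ _) (pair-0 P)

  pair-+ : ∀ (u v : Weight r) P → pair (λ i → u i + v i) P ≡ pair u P + pair v P
  pair-+ u v [] = refl
  pair-+ u v ((i , c) ∷ P) =
    trans (cong (λ t → (u i + v i) * c + t) (pair-+ u v P)) (lemma (u i) (v i) c _ _)
    where lemma : ∀ a b c s t → (a + b) * c + (s + t) ≡ (a * c + s) + (b * c + t)
          lemma = solve-∀

  pair-* : ∀ (u : Weight r) c P → pair (λ i → u i * c) P ≡ pair u P * c
  pair-* u c [] = refl
  pair-* u c ((i , d) ∷ P) =
    trans (cong (λ t → u i * c * d + t) (pair-* u c P)) (lemma (u i) c d _)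
    where lemma : ∀ a c d t → a * c * d + t * c ≡ (a * d + t) * c
          lemma = solve-∀

  pair-swap : ∀ (f : Vec ℤ r → Vec ℤ r → ℤ) P Q →
              pair (λ i → pair (f i) Q) P ≡ pair (λ j → pair (λ i → f i j) P) Q
  pair-swap f [] Q = sym (pair-0 Q)
  pair-swap f ((i , c) ∷ P) Q = begin
    pair (f i) Q * c + pair (λ i → pair (f i) Q) P
      ≡⟨ cong₂ _+_ (sym (pair-* (f i) c Q)) (pair-swap f P Q) ⟩
    pair (λ j → f i j * c) Q + pair (λ j → pair (λ i → f i j) P) Q
      ≡⟨ sym (pair-+ _ _ Q) ⟩
    pair (λ j → f i j * c + pair (λ i → f i j) P) Q ∎
    where open ≡-Reasoning

  -- The two lemmas below are stated for arbitrary functions so that they apply to the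
  -- pattern-matching lambdas inside the definition of _·_.
  pair-map : ∀ w i c (g : Vec ℤ r × ℤ → Vec ℤ r × ℤ) →
             (∀ j d → g (j , d) ≡ (i ⊕ j , c * d)) →
             ∀ Q → pair w (map g Q) ≡ pair (w ∘ (i ⊕_)) Q * c
  pair-map w i c g g-def [] = refl
  pair-map w i c g g-def ((j , d) ∷ Q) rewrite g-def j d =
    trans (cong (λ t → w (i ⊕ j) * (c * d) + t) (pair-map w i c g g-def Q)) (lemma (w (i ⊕ j)) c d _)
    where lemma : ∀ a c d t → a * (c * d) + t * c ≡ (a * d + t) * c
          lemma = solve-∀

  pair-concatMap : ∀ w (f : Vec ℤ r × ℤ → LPoly r) (u : Weight r) →
                   (∀ i c → pair w (f (i , c)) ≡ u i * c) →
                   ∀ P → pair w (concatMap f P) ≡ pair u P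
  pair-concatMap w f u f-def [] = refl
  pair-concatMap w f u f-def ((i , c) ∷ P) =
    trans (pair-++ w (f (i , c)) (concatMap f P))
          (cong₂ _+_ (f-def i c) (pair-concatMap w f u f-def P))

  pair-·ˡ : ∀ w (P Q : LPoly r) → pair w (P · Q) ≡ pair (λ i → pair (w ∘ (i ⊕_)) Q) P
  pair-·ˡ w P Q = pair-concatMap w _ _ (λ i c → pair-map w i c _ (λ _ _ → refl) Q) P

  pair-·ʳ : ∀ w (P Q : LPoly r) → pair w (P · Q) ≡ pair (λ j → pair (λ i → w (i ⊕ j)) P) Q
  pair-·ʳ w P Q = trans (pair-·ˡ w P Q) (pair-swap (λ i j → w (i ⊕ j)) P Q)

infix 4 _≈_[mod_]

record _≈_[mod_] {r} (A B : LPoly r) (m : ℕ) : Set where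
  constructor pairings-≋
  field pair-≋ : ∀ w → pair w A ≋ pair w B [mod m ]

open _≈_[mod_]

module _ {m r : ℕ} where

  ≈-setoid : Setoid _ _
  ≈-setoid = record
    { Carrier = LPoly r
    ; _≈_ = _≈_[mod m ]
    ; isEquivalence = record
      { refl  = pairings-≋ λ w → ≡⇒≋ refl
      ; sym   = λ A≈B → pairings-≋ λ w → ≋-sym (pair-≋ A≈B w)
      ; trans = λ A≈B B≈C → pairings-≋ λ w → ≋-trans (pair-≋ A≈B w) (pair-≋ B≈C w)
      }
    }

  open Setoid ≈-setoid public using () renaming (refl to ≈-refl; sym to ≈-sym; trans to ≈-trans)

  pairs-≡⇒≈ : ∀ {A B : LPoly r} → (∀ w → pair w A ≡ pair w B) → A ≈ B [mod m ]
  pairs-≡⇒≈ eq = pairings-≋ λ w → ≡⇒≋ (eq w)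

  pair-cong-≋ : ∀ {u v : Weight r} → (∀ i → u i ≋ v i [mod m ]) →
                ∀ P → pair u P ≋ pair v P [mod m ]
  pair-cong-≋ u≋v [] = ≡⇒≋ refl
  pair-cong-≋ u≋v ((i , c) ∷ P) = +-cong-≋ (*-congʳ-≋ c (u≋v i)) (pair-cong-≋ u≋v P)

  ·-congʳ : ∀ P {Q Q'} → Q ≈ Q' [mod m ] → P · Q ≈ P · Q' [mod m ]
  ·-congʳ P {Q} {Q'} Q≈Q' = pairings-≋ λ w → begin
    pair w (P · Q)                      ≡⟨ pair-·ˡ w P Q ⟩
    pair (λ i → pair (w ∘ (i ⊕_)) Q) P  ≈⟨ pair-cong-≋ (λ i → pair-≋ Q≈Q' (w ∘ (i ⊕_))) P ⟩
    pair (λ i → pair (w ∘ (i ⊕_)) Q') P ≡⟨ pair-·ˡ w P Q' ⟨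
    pair w (P · Q')                     ∎
    where open SetoidReasoning ≋-setoid

  ·-congˡ : ∀ {P P'} Q → P ≈ P' [mod m ] → P · Q ≈ P' · Q [mod m ]
  ·-congˡ {P} {P'} Q P≈P' = pairings-≋ λ w → begin
    pair w (P · Q)                             ≡⟨ pair-·ʳ w P Q ⟩
    pair (λ j → pair (λ i → w (i ⊕ j)) P) Q    ≈⟨ pair-cong-≋ (λ j → pair-≋ P≈P' (λ i → w (i ⊕ j))) Q ⟩
    pair (λ j → pair (λ i → w (i ⊕ j)) P') Q   ≡⟨ pair-·ʳ w P' Q ⟨
    pair w (P' · Q)                            ∎
    where open SetoidReasoning ≋-setoid

  ·-cong : ∀ {P P' Q Q'} → P ≈ P' [mod m ] → Q ≈ Q' [mod m ] → P · Q ≈ P' · Q' [mod m ]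
  ·-cong {P} {P'} {Q} P≈P' Q≈Q' = ≈-trans (·-congˡ Q P≈P') (·-congʳ P' Q≈Q')

  ·-assoc : ∀ A B C → (A · B) · C ≈ A · (B · C) [mod m ]
  ·-assoc A B C = pairs-≡⇒≈ λ w → begin
    pair w ((A · B) · C)
      ≡⟨ pair-·ˡ w (A · B) C ⟩
    pair (λ k → pair (λ l → w (k ⊕ l)) C) (A · B)
      ≡⟨ pair-·ˡ _ A B ⟩
    pair (λ i → pair (λ j → pair (λ l → w (i ⊕ j ⊕ l)) C) B) A
      ≡⟨ pair-cong (λ i → pair-cong (λ j → pair-cong (λ l → cong w (⊕-assoc i j l)) C) B) A ⟩
    pair (λ i → pair (λ j → pair (λ l → w (i ⊕ (j ⊕ l))) C) B) A
      ≡⟨ pair-cong (λ i → pair-·ˡ (w ∘ (i ⊕_)) B C) A ⟨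
    pair (λ i → pair (w ∘ (i ⊕_)) (B · C)) A
      ≡⟨ pair-·ˡ w A (B · C) ⟨
    pair w (A · (B · C)) ∎
    where
      open ≡-Reasoning
      ⊕-assoc : ∀ (i j k : Vec ℤ r) → i ⊕ j ⊕ k ≡ i ⊕ (j ⊕ k)
      ⊕-assoc i j k = Pointwise-≡⇒≡ (zipWith-assoc +-assoc i j k)

  one-· : ∀ A → one · A ≈ A [mod m ]
  one-· A = pairs-≡⇒≈ λ w → begin
    pair w (one · A)                     ≡⟨ pair-·ˡ w one A ⟩
    pair (w ∘ (0ᵥ ⊕_)) A * 1ℤ + 0ℤ        ≡⟨ +-identityʳ _ ⟩
    pair (w ∘ (0ᵥ ⊕_)) A * 1ℤ             ≡⟨ *-identityʳ _ ⟩
    pair (w ∘ (0ᵥ ⊕_)) A                  ≡⟨ pair-cong (cong w ∘ 0ᵥ⊕) A ⟩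
    pair w A                              ∎
    where
      open ≡-Reasoning
      0ᵥ : Vec ℤ r
      0ᵥ = replicate r 0ℤ
      0ᵥ⊕ : ∀ i → 0ᵥ ⊕ i ≡ i
      0ᵥ⊕ i = Pointwise-≡⇒≡ (zipWith-identityˡ +-identityˡ i)

  ^-+ : ∀ A a b → A ^ (a ℕ.+ b) ≈ A ^ a · A ^ b [mod m ]
  ^-+ A zero b = ≈-sym (one-· (A ^ b))
  ^-+ A (suc a) b = ≈-trans (·-congʳ A (^-+ A a b)) (≈-sym (·-assoc A (A ^ a) (A ^ b)))

  ^-* : ∀ A a b → A ^ (a ℕ.* b) ≈ (A ^ a) ^ b [mod m ]
  ^-* A a zero rewrite ℕ.*-zeroʳ a = ≈-refl
  ^-* A a (suc b) rewrite ℕ.*-suc a b = ≈-trans (^-+ A a (a ℕ.* b)) (·-congʳ (A ^ a) (^-* A a b))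

  ^-cong : ∀ {A B} n → A ≈ B [mod m ] → A ^ n ≈ B ^ n [mod m ]
  ^-cong zero A≈B = ≈-refl
  ^-cong (suc n) A≈B = ·-cong A≈B (^-cong n A≈B)

module _ {r : ℕ} where

  without : Vec ℤ r → LPoly r → LPoly r
  without i [] = []
  without i ((j , d) ∷ R) with ≡-dec _≟_ j i
  ... | yes _ = without i R
  ... | no  _ = (j , d) ∷ without i R

  length-without : ∀ i R → length (without i R) ℕ.≤ length R
  length-without i [] = z≤n
  length-without i ((j , d) ∷ R) with ≡-dec _≟_ j i
  ... | yes _ = ℕ.m≤n⇒m≤1+n (length-without i R)
  ... | no  _ = s≤s (length-without i R)

  length-without-head : ∀ i c R → length (without i ((i , c) ∷ R)) ℕ.≤ length R
  length-without-head i c R with ≡-dec _≟_ i i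
  ... | yes _  = length-without i R
  ... | no i≢i = ⊥-elim (i≢i refl)

  coeff-without-≡ : ∀ i R → coeff (without i R) i ≡ 0ℤ
  coeff-without-≡ i [] = refl
  coeff-without-≡ i ((j , d) ∷ R) with ≡-dec _≟_ j i
  ... | yes _ = coeff-without-≡ i R
  ... | no j≢i with ≡-dec _≟_ j i
  ...   | yes j≡i = ⊥-elim (j≢i j≡i)
  ...   | no  _   = coeff-without-≡ i R

  coeff-without-≢ : ∀ i e R → e ≢ i → coeff (without i R) e ≡ coeff R e
  coeff-without-≢ i e [] e≢i = refl
  coeff-without-≢ i e ((j , d) ∷ R) e≢i with ≡-dec _≟_ j i
  ... | yes refl with ≡-dec _≟_ j e
  ...   | yes refl = ⊥-elim (e≢i refl)
  ...   | no  _    = coeff-without-≢ i e R e≢i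
  coeff-without-≢ i e ((j , d) ∷ R) e≢i | no _ with ≡-dec _≟_ j e
  ...   | yes _ = cong (_+_ d) (coeff-without-≢ i e R e≢i)
  ...   | no  _ = coeff-without-≢ i e R e≢i

  pair-without : ∀ w i R → pair w R ≡ w i * coeff R i + pair w (without i R)
  pair-without w i [] = sym (trans (+-identityʳ _) (*-zeroʳ (w i)))
  pair-without w i ((j , d) ∷ R) with ≡-dec _≟_ j i
  ... | yes refl = trans (cong (λ t → w j * d + t) (pair-without w j R)) (lemma (w j) d (coeff R j) (pair w (without j R)))
    where lemma : ∀ a b c t → a * b + (a * c + t) ≡ a * (b + c) + t
          lemma = solve-∀
  ... | no  _    = trans (cong (λ t → w j * d + t) (pair-without w i R)) (lemma (w j * d) (w i * coeff R i) (pair w (without i R)))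
    where lemma : ∀ a b t → a + (b + t) ≡ b + (a + t)
          lemma = solve-∀

  coeff-++ : ∀ (A B : LPoly r) e → coeff (A ++ B) e ≡ coeff A e + coeff B e
  coeff-++ [] B e = sym (+-identityˡ _)
  coeff-++ ((i , c) ∷ A) B e with ≡-dec _≟_ i e
  ... | yes _ = trans (cong (_+_ c) (coeff-++ A B e)) (sym (+-assoc c _ _))
  ... | no  _ = coeff-++ A B e

  negate : LPoly r → LPoly r
  negate = map (map₂ (λ c → - c))

  coeff-negate : ∀ (A : LPoly r) e → coeff (negate A) e ≡ - coeff A e
  coeff-negate [] e = refl
  coeff-negate ((i , c) ∷ A) e with ≡-dec _≟_ i e
  ... | yes _ = trans (cong (_+_ (- c)) (coeff-negate A e)) (sym (neg-distrib-+ c (coeff A e)))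
  ... | no  _ = coeff-negate A e

  pair-negate : ∀ w (A : LPoly r) → pair w (negate A) ≡ - pair w A
  pair-negate w [] = refl
  pair-negate w ((i , c) ∷ A) =
    trans (cong (λ t → w i * - c + t) (pair-negate w A)) (lemma (w i) c (pair w A))
    where lemma : ∀ a b t → a * - b + - t ≡ - (a * b + t)
          lemma = solve-∀

  module _ {m : ℕ} where

    -- Strong induction on the number of terms: the terms with the exponent i of the
    -- first term add up to w i times the coefficient at i, and are then removed.
    coeffs-≋0⇒pair-≋0 : ∀ n (D : LPoly r) → length D ℕ.≤ n →
                        (∀ e → coeff D e ≋ 0ℤ [mod m ]) → ∀ w → pair w D ≋ 0ℤ [mod m ]
    coeffs-≋0⇒pair-≋0 _ [] _ _ w = ≡⇒≋ refl
    coeffs-≋0⇒pair-≋0 (suc n) D@((i , c) ∷ R) (s≤s |R|≤n) D≋0 w = begin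
      pair w D                                 ≡⟨ pair-without w i D ⟩
      w i * coeff D i + pair w (without i D)   ≈⟨ +-cong-≋ (*-congˡ-≋ (w i) (D≋0 i)) rest≋0 ⟩
      w i * 0ℤ + 0ℤ                            ≡⟨ trans (+-identityʳ _) (*-zeroʳ (w i)) ⟩
      0ℤ                                       ∎
      where
        open SetoidReasoning ≋-setoid
        coeff-rest≋0 : ∀ e → coeff (without i D) e ≋ 0ℤ [mod m ]
        coeff-rest≋0 e with ≡-dec _≟_ e i
        ... | yes refl = ≡⇒≋ (coeff-without-≡ e D)
        ... | no  e≢i  = subst (_≋ 0ℤ [mod m ]) (sym (coeff-without-≢ i e D e≢i)) (D≋0 e)
        rest≋0 : pair w (without i D) ≋ 0ℤ [mod m ]
        rest≋0 = coeffs-≋0⇒pair-≋0 n (without i D) (ℕ.≤-trans (length-without-head i c R) |R|≤n) coeff-rest≋0 w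

    ≅⇒≈ : ∀ {A B : LPoly r} → A ≅[mod m ] B → A ≈ B [mod m ]
    ≅⇒≈ {A} {B} A≅B = pairings-≋ λ w →
      -≋0⇒≋ (subst (_≋ 0ℤ [mod m ]) (pair-difference w)
               (coeffs-≋0⇒pair-≋0 _ (A ++ negate B) ℕ.≤-refl coeff-difference≋0 w))
      where
        pair-difference : ∀ w → pair w (A ++ negate B) ≡ pair w A - pair w B
        pair-difference w = trans (pair-++ w A (negate B)) (cong (_+_ (pair w A)) (pair-negate w B))
        coeff-difference≋0 : ∀ e → coeff (A ++ negate B) e ≋ 0ℤ [mod m ]
        coeff-difference≋0 e =
          subst (_≋ 0ℤ [mod m ]) (sym (trans (coeff-++ A (negate B) e) (cong (_+_ (coeff A e)) (coeff-negate B e))))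
                (≋⇒-≋0 (≡[mod]⇒≋ {x = coeff A e} {y = coeff B e} (A≅B e)))

-- The substitution x ↦ x^N

scale : ∀ {r} → ℕ → Vec ℤ r → Vec ℤ r
scale N = Vec.map (λ z → + N * z)

scale-⊕ : ∀ {r} N (i j : Vec ℤ r) → scale N (i ⊕ j) ≡ scale N i ⊕ scale N j
scale-⊕ N [] [] = refl
scale-⊕ N (x ∷ i) (y ∷ j) = cong₂ _∷_ (*-distribˡ-+ (+ N) x y) (scale-⊕ N i j)

module _ {r : ℕ} (N : ℕ) where

  scale-0 : scale N (replicate r 0ℤ) ≡ replicate r 0ℤ
  scale-0 = trans (map-replicate _ 0ℤ r) (cong (λ z → replicate r z) (*-zeroʳ (+ N)))

  pair-substPow : ∀ w (A : LPoly r) → pair w (substPow N A) ≡ pair (w ∘ scale N) A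
  pair-substPow w [] = refl
  pair-substPow w ((i , c) ∷ A) = cong (λ t → w (scale N i) * c + t) (pair-substPow w A)

  module _ {m : ℕ} where

    substPow-· : ∀ (A B : LPoly r) → substPow N (A · B) ≈ substPow N A · substPow N B [mod m ]
    substPow-· A B = pairs-≡⇒≈ λ w → begin
      pair w (substPow N (A · B))
        ≡⟨ pair-substPow w (A · B) ⟩
      pair (w ∘ scale N) (A · B)
        ≡⟨ pair-·ˡ _ A B ⟩
      pair (λ i → pair (λ j → w (scale N (i ⊕ j))) B) A
        ≡⟨ pair-cong (λ i → pair-cong (λ j → cong w (scale-⊕ N i j)) B) A ⟩
      pair (λ i → pair (λ j → w (scale N i ⊕ scale N j)) B) A
        ≡⟨ pair-cong (λ i → pair-substPow (w ∘ (scale N i ⊕_)) B) A ⟨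
      pair (λ i → pair (w ∘ (scale N i ⊕_)) (substPow N B)) A
        ≡⟨ pair-substPow (λ i → pair (w ∘ (i ⊕_)) (substPow N B)) A ⟨
      pair (λ i → pair (w ∘ (i ⊕_)) (substPow N B)) (substPow N A)
        ≡⟨ pair-·ˡ w (substPow N A) (substPow N B) ⟨
      pair w (substPow N A · substPow N B) ∎
      where open ≡-Reasoning

    substPow-one : substPow N one ≈ one [mod m ]
    substPow-one = pairs-≡⇒≈ λ w → cong (λ v → w v * 1ℤ + 0ℤ) scale-0

    substPow-^ : ∀ (A : LPoly r) n → substPow N A ^ n ≈ substPow N (A ^ n) [mod m ]
    substPow-^ A zero = ≈-sym substPow-one
    substPow-^ A (suc n) = ≈-trans (·-congʳ (substPow N A) (substPow-^ A n)) (≈-sym (substPow-· A (A ^ n)))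

-- Coefficients as pairings, and the operator Λ_N

δ : ∀ {r} → Vec ℤ r → Weight r
δ e v with ≡-dec _≟_ v e
... | yes _ = 1ℤ
... | no  _ = 0ℤ

module _ {r : ℕ} where

  δ-≢ : ∀ {e v : Vec ℤ r} → v ≢ e → δ e v ≡ 0ℤ
  δ-≢ {e} {v} v≢e with ≡-dec _≟_ v e
  ... | yes v≡e = ⊥-elim (v≢e v≡e)
  ... | no  _   = refl

  δ-cong : ∀ {e v e' v' : Vec ℤ r} → (v ≡ e → v' ≡ e') → (v' ≡ e' → v ≡ e) → δ e v ≡ δ e' v'
  δ-cong {e} {v} {e'} {v'} to from with ≡-dec _≟_ v e | ≡-dec _≟_ v' e'
  ... | yes _    | yes _     = refl
  ... | yes v≡e  | no  v'≢e' = ⊥-elim (v'≢e' (to v≡e))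
  ... | no  v≢e  | yes v'≡e' = ⊥-elim (v≢e (from v'≡e'))
  ... | no  _    | no  _     = refl

  coeff≡pair-δ : ∀ (P : LPoly r) e → coeff P e ≡ pair (δ e) P
  coeff≡pair-δ [] e = refl
  coeff≡pair-δ ((i , c) ∷ P) e with ≡-dec _≟_ i e
  ... | yes _ = cong₂ _+_ (sym (*-identityˡ c)) (coeff≡pair-δ P e)
  ... | no  _ = trans (coeff≡pair-δ P e) (sym (+-identityˡ _))

  ct-cong : ∀ {m} {A B : LPoly r} → A ≈ B [mod m ] → ct A ≋ ct B [mod m ]
  ct-cong {A = A} {B} A≈B =
    subst₂ (_≋_[mod _ ]) (sym (coeff≡pair-δ A _)) (sym (coeff≡pair-δ B _)) (pair-≋ A≈B (δ _))

divide : ∀ {r} N .{{_ : NonZero N}} → Vec ℤ r → Vec ℤ r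
divide N = Vec.map (λ z → z /ℕ N)

Divisible : ∀ {r} → ℕ → Vec ℤ r → Set
Divisible N = All (λ z → N ℕ.∣ ∣ z ∣)

module _ (N : ℕ) .{{_ : NonZero N}} where

  %ℕ-divisible : ∀ z → N ℕ.∣ ∣ z ∣ → z %ℕ N ≡ 0
  %ℕ-divisible (+ n) N∣n = ℕ.n∣m⇒m%n≡0 n N N∣n
  %ℕ-divisible -[1+ n ] N∣n with suc n ℕ.% N | ℕ.n∣m⇒m%n≡0 (suc n) N N∣n
  ... | .0 | refl = refl

  *-/ℕ-divisible : ∀ z → N ℕ.∣ ∣ z ∣ → + N * (z /ℕ N) ≡ z
  *-/ℕ-divisible z N∣z = begin
    + N * (z /ℕ N)              ≡⟨ *-comm (+ N) (z /ℕ N) ⟩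
    (z /ℕ N) * + N              ≡⟨ +-identityˡ _ ⟨
    + 0 + (z /ℕ N) * + N        ≡⟨ cong (λ t → + t + (z /ℕ N) * + N) (%ℕ-divisible z N∣z) ⟨
    + (z %ℕ N) + (z /ℕ N) * + N ≡⟨ a≡a%ℕn+[a/ℕn]*n z N ⟨
    z                           ∎
    where open ≡-Reasoning

  scale-divide : ∀ {r} {j : Vec ℤ r} → Divisible N j → scale N (divide N j) ≡ j
  scale-divide [] = refl
  scale-divide {j = z ∷ _} (N∣z ∷ N∣j) = cong₂ _∷_ (*-/ℕ-divisible z N∣z) (scale-divide N∣j)

  scale-injective : ∀ {r} (u v : Vec ℤ r) → scale N u ≡ scale N v → u ≡ v
  scale-injective [] [] _ = refl
  scale-injective (x ∷ u) (y ∷ v) eq =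
    cong₂ _∷_ (*-cancelˡ-≡ (+ N) x y (proj₁ (∷-injective eq))) (scale-injective u v (proj₂ (∷-injective eq)))

  divisible-coordinate : ∀ x y z → + N * x + z ≡ + N * y → N ℕ.∣ ∣ z ∣
  divisible-coordinate x y z eq = subst (N ℕ.∣_) (sym ∣z∣≡N∣y-x∣) (ℕ.m∣m*n ∣ y - x ∣)
    where
      open ≡-Reasoning
      ∣z∣≡N∣y-x∣ : ∣ z ∣ ≡ N ℕ.* ∣ y - x ∣
      ∣z∣≡N∣y-x∣ = begin
        ∣ z ∣                          ≡⟨ cong ∣_∣ (lemma (+ N * x) z) ⟩
        ∣ (+ N * x + z) - + N * x ∣    ≡⟨ cong (λ t → ∣ t - + N * x ∣) eq ⟩
        ∣ + N * y - + N * x ∣          ≡⟨ cong ∣_∣ (factor (+ N) y x) ⟩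
        ∣ + N * (y - x) ∣              ≡⟨ abs-* (+ N) (y - x) ⟩
        N ℕ.* ∣ y - x ∣                ∎
        where lemma : ∀ a b → b ≡ (a + b) - a
              lemma = solve-∀
              factor : ∀ n a b → n * a - n * b ≡ n * (a - b)
              factor = solve-∀

  divisible-⊕ : ∀ {r} (i j e : Vec ℤ r) → scale N i ⊕ j ≡ scale N e → Divisible N j
  divisible-⊕ [] [] [] _ = []
  divisible-⊕ (x ∷ i) (z ∷ j) (y ∷ e) eq =
    divisible-coordinate x y z (proj₁ (∷-injective eq)) ∷ divisible-⊕ i j e (proj₂ (∷-injective eq))

  δ-scale-⊕-divisible : ∀ {r} (e i : Vec ℤ r) {j} → Divisible N j →
                        δ (scale N e) (scale N i ⊕ j) ≡ δ e (i ⊕ divide N j)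
  δ-scale-⊕-divisible e i {j} N∣j =
    δ-cong (λ eq → scale-injective _ e (trans (sym factored) eq))
           (λ eq → trans factored (cong (scale N) eq))
    where
      factored : scale N i ⊕ j ≡ scale N (i ⊕ divide N j)
      factored = trans (cong (scale N i ⊕_) (sym (scale-divide N∣j))) (sym (scale-⊕ N i (divide N j)))

  δ-scale-⊕-indivisible : ∀ {r} (e i : Vec ℤ r) {j} → ¬ Divisible N j →
                          δ (scale N e) (scale N i ⊕ j) ≡ 0ℤ
  δ-scale-⊕-indivisible e i {j} N∤j = δ-≢ (λ eq → N∤j (divisible-⊕ i j e eq))

module _ {r : ℕ} where

  pair-Λ : ∀ N .{{_ : NonZero N}} (e i : Vec ℤ r) B →
           pair (δ (scale N e) ∘ (scale N i ⊕_)) B ≡ pair (δ e ∘ (i ⊕_)) (Λ N B)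
  pair-Λ (suc k) e i [] = refl
  pair-Λ (suc k) e i ((j , d) ∷ B) with all? (λ z → suc k ℕ.∣? ∣ z ∣) j
  ... | yes N∣j = cong₂ (λ a t → a * d + t) (δ-scale-⊕-divisible (suc k) e i N∣j) (pair-Λ (suc k) e i B)
  ... | no  N∤j = begin
    δ (scale N e) (scale N i ⊕ j) * d + pair (δ (scale N e) ∘ (scale N i ⊕_)) B
      ≡⟨ cong (λ a → a * d + pair (δ (scale N e) ∘ (scale N i ⊕_)) B) (δ-scale-⊕-indivisible N e i N∤j) ⟩
    0ℤ + pair (δ (scale N e) ∘ (scale N i ⊕_)) B
      ≡⟨ +-identityˡ _ ⟩
    pair (δ (scale N e) ∘ (scale N i ⊕_)) B
      ≡⟨ pair-Λ N e i B ⟩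
    pair (δ e ∘ (i ⊕_)) (Λ N B) ∎
    where
      open ≡-Reasoning
      N = suc k

  coeff-substPow-·-Λ : ∀ N .{{_ : NonZero N}} (A B : LPoly r) e →
                       coeff (substPow N A · B) (scale N e) ≡ coeff (A · Λ N B) e
  coeff-substPow-·-Λ N A B e = begin
    coeff (substPow N A · B) (scale N e)
      ≡⟨ coeff≡pair-δ (substPow N A · B) (scale N e) ⟩
    pair (δ (scale N e)) (substPow N A · B)
      ≡⟨ pair-·ˡ _ (substPow N A) B ⟩
    pair (λ i → pair (δ (scale N e) ∘ (i ⊕_)) B) (substPow N A)
      ≡⟨ pair-substPow N _ A ⟩
    pair (λ i → pair (δ (scale N e) ∘ (scale N i ⊕_)) B) A
      ≡⟨ pair-cong (λ i → pair-Λ N e i B) A ⟩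
    pair (λ i → pair (δ e ∘ (i ⊕_)) (Λ N B)) A
      ≡⟨ pair-·ˡ _ A (Λ N B) ⟨
    pair (δ e) (A · Λ N B)
      ≡⟨ coeff≡pair-δ (A · Λ N B) e ⟨
    coeff (A · Λ N B) e ∎
    where open ≡-Reasoning

  ct-substPow-·-Λ : ∀ N .{{_ : NonZero N}} (A B : LPoly r) → ct (substPow N A · B) ≡ ct (A · Λ N B)
  ct-substPow-·-Λ N A B =
    trans (cong (coeff (substPow N A · B)) (sym (scale-0 N))) (coeff-substPow-·-Λ N A B (replicate r 0ℤ))

module _ {r m : ℕ} (N : ℕ) .{{_ : NonZero N}} (P Q P̃ : LPoly r) (M : ℕ)
         (P^M≅P̃[x^N] : (P ^ M) ≅[mod m ] substPow N P̃) where

  power-·≈substPow : ∀ n k → P ^ (M ℕ.* n ℕ.+ k) · Q ≈ substPow N (P̃ ^ n) · (P ^ k · Q) [mod m ]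
  power-·≈substPow n k = begin
    P ^ (M ℕ.* n ℕ.+ k) · Q          ≈⟨ ·-congˡ Q (^-+ P (M ℕ.* n) k) ⟩
    (P ^ (M ℕ.* n) · P ^ k) · Q      ≈⟨ ·-assoc (P ^ (M ℕ.* n)) (P ^ k) Q ⟩
    P ^ (M ℕ.* n) · (P ^ k · Q)      ≈⟨ ·-congˡ _ (^-* P M n) ⟩
    (P ^ M) ^ n · (P ^ k · Q)        ≈⟨ ·-congˡ _ (^-cong n (≅⇒≈ P^M≅P̃[x^N])) ⟩
    substPow N P̃ ^ n · (P ^ k · Q)   ≈⟨ ·-congˡ _ (substPow-^ N P̃ n) ⟩
    substPow N (P̃ ^ n) · (P ^ k · Q) ∎
    where open SetoidReasoning ≈-setoid

  ct-power-decimation : ∀ n k →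
    ct (P ^ (M ℕ.* n ℕ.+ k) · Q) ≡[mod m ] ct (P̃ ^ n · Λ N (P ^ k · Q))
  ct-power-decimation n k = ≋⇒≡[mod] (begin
    ct (P ^ (M ℕ.* n ℕ.+ k) · Q)         ≈⟨ ct-cong (power-·≈substPow n k) ⟩
    ct (substPow N (P̃ ^ n) · (P ^ k · Q)) ≡⟨ ct-substPow-·-Λ N (P̃ ^ n) (P ^ k · Q) ⟩
    ct (P̃ ^ n · Λ N (P ^ k · Q))          ∎)
    where open SetoidReasoning ≋-setoid

-- Primality only serves to make p^ℓ nonzero.
proposition23 : (p a r : ℕ) → Prime p → a ℕ.≥ 1 →
    (P Q Pt : LPoly r) (ℓ : ℕ) → IsTilde p a P Pt ℓ →
    (n k : ℕ) → k ℕ.< p ℕ.^ (a ℕ.∸ 1) →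
    ct ((P ^ (p ℕ.^ (a ℕ.∸ 1) ℕ.* n ℕ.+ k)) · Q)
      ≡[mod p ℕ.^ a ] ct ((Pt ^ n) · Λ (p ℕ.^ ℓ) ((P ^ k) · Q))
proposition23 p a r p-prime _ P Q Pt ℓ (P^pᵃ⁻¹≅Pt[x^pˡ] , _) n k _ =
  ct-power-decimation (p ℕ.^ ℓ) {{ℕ.m^n≢0 p ℓ {{prime⇒nonZero p-prime}}}}
    P Q Pt (p ℕ.^ (a ℕ.∸ 1)) P^pᵃ⁻¹≅Pt[x^pˡ] n k
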